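{- Let $k$ be a positive integer. For every $n \geq \binom{k}{2}+1$, we have $\mathrm{r}_n(12\cdots k)=0$; that is, for every permutation $\pi \in \mathcal{S}_n$ with $n\ge \binom{k}{2}+1$, the word $\pi\pi^r$ contains the pattern $12\cdots k$.
   Context: $\mathcal{S}_n$ is the set of permutations of $[n]=\{1,\dots,n\}$, written in one-line notation $\pi=\pi_1\cdots\pi_n$, and $\pi^r=\pi_n\cdots\pi_1$ is its reversal. A word $w=w_1\cdots w_m$ contains a pattern $\rho\in\mathcal{S}_k$ if there are indices $1\le i_1<\cdots<i_k\le m$ with $w_{i_a}\le w_{i_b}$ if and only if $\rho_a\le\rho_b$; otherwise $w$ avoids $\rho$. The set of reverse double lists on $n$ letters is $\mathcal{R}_n=\{\pi\pi^r : \pi\in\mathcal{S}_n\}$ (concatenation of $\pi$ with its reversal), $\mathcal{R}_n(\rho)$ is the set of members of $\mathcal{R}_n$ avoiding $\rho$, and $\mathrm{r}_n(\rho)=|\mathcal{R}_n(\rho)|$. The pattern $12\cdots k$ is the identity permutation of length $k$. -}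

module Defs where

open import Data.Nat using (ℕ; suc; _+_; _≤_)
open import Data.Fin using (Fin; toℕ; _<_; splitAt)
open import Data.Fin.Permutation using (Permutation; _⟨$⟩ʳ_)
open import Data.Sum using (inj₁; inj₂)
open import Data.Product using (Σ; _×_)
open import Function.Bundles using (_⇔_)

Word : ℕ → Set
Word m = Fin m → ℕ

-- One-line notation of a permutation π ∈ S_n: position i (0-based) holds π(i)+1 ∈ [n].
oneLine : ∀ {n} → Permutation n n → Word n
oneLine π i = suc (toℕ (π ⟨$⟩ʳ i))

reverseW : ∀ {m} → Word m → Word m
reverseW {m} w i = w (Data.Fin.opposite i)

concatW : ∀ {m l} → Word m → Word l → Word (m + l)
concatW {m} w v i with splitAt m i
... | inj₁ j = w j
... | inj₂ j = v j

doubleList : ∀ {n} → Permutation n n → Word (n + n)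
doubleList π = concatW (oneLine π) (reverseW (oneLine π))

Contains : ∀ {m k} → Word m → Word k → Set
Contains {m} {k} w ρ =
  Σ (Fin k → Fin m) λ idx →
    (∀ (a b : Fin k) → a < b → idx a < idx b) ×
    (∀ (a b : Fin k) → (w (idx a) ≤ w (idx b)) ⇔ (ρ a ≤ ρ b))

identityPattern : (k : ℕ) → Word k
identityPattern k a = suc (toℕ a)

-- Read π π^r as ρ^r ρ with ρ = π^r, and label each entry x of ρ by the pair
-- (a, b) of lengths of a longest increasing and a longest decreasing
-- subsequence of ρ that can follow x. Reversing the decreasing one and
-- appending the increasing one gives an increasing subsequence of ρ^r ρ of
-- length 1 + a + b through both copies of x. As in the Erdős–Szekeres
-- argument the labels are pairwise distinct, and there are only C(k,2)
-- pairs with a + b ≤ k - 2; so when n > C(k,2) some label has a + b ≥ k - 1.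

module Submission where

open import Defs
open import Data.Nat.Combinatorics using (_C_; nC1≡n; nCk+nC[k+1]≡[n+1]C[k+1])
open import Data.Fin.Permutation using (Permutation; _⟨$⟩ʳ_; _⟨$⟩ˡ_; inverseˡ)

open import Data.Nat using (ℕ; zero; suc; _+_; _⊔_; _≤_; _<_; _>_; _≤?_; _<?_; _>?_; z≤n; s≤s)
open import Data.Nat.Properties
open import Data.Fin as F using (Fin; zero; suc; toℕ; inject₁; inject≤; fromℕ; opposite; splitAt)
open import Data.Fin.Properties using (toℕ-injective; toℕ-inject≤; opposite-involutive)
open import Data.Product using (Σ; _×_; _,_; map₁)
open import Data.Sum using (inj₁; inj₂)
open import Data.List using (List; []; _∷_; [_]; _++_; length; map; reverse; tabulate; lookup)
open import Data.List.Properties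
  using (length-++; length-map; length-reverse; length-tabulate; tabulate-cong; reverse-++; reverse-involutive; unfold-reverse)
open import Data.List.Relation.Unary.All as All using (All; []; _∷_)
import Data.List.Relation.Unary.All.Properties as All
open import Data.List.Relation.Unary.Any using (Any; here; there; any?)
open import Data.List.Relation.Unary.AllPairs using (AllPairs; []; _∷_)
import Data.List.Relation.Unary.AllPairs.Properties as AllPairs
open import Data.List.Relation.Unary.Unique.Propositional using (Unique)
import Data.List.Relation.Unary.Unique.Propositional.Properties as Unique
open import Data.List.Membership.Propositional using (_∈_)
open import Data.List.Membership.Propositional.Properties using (∈-map⁺; ∈-++⁺ˡ; ∈-++⁺ʳ; ∈-++⁻; ∈-∃++; ∈-lookup)
import Data.List.Relation.Unary.Any.Properties as Any
open import Data.List.Relation.Binary.Sublist.Propositional using (_⊆_; []; _∷_; _∷ʳ_; ⊆-refl; ⊆-trans)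
import Data.List.Relation.Binary.Sublist.Propositional.Properties as Sublist
open import Data.Empty using (⊥-elim)
open import Function using (_∘_; flip)
open import Function.Bundles using (_⇔_; mk⇔)
open import Relation.Binary.Core using (_Preserves_⟶_)
open import Relation.Binary.Definitions using (Transitive; Decidable; tri<; tri≈; tri>)
open import Relation.Binary.PropositionalEquality using (_≡_; refl; sym; trans; cong; cong₂; subst; subst₂; module ≡-Reasoning)
open import Relation.Nullary using (¬_; yes; no)

private
  variable
    A : Set

All-reverse⁺ : {P : A → Set} {xs : List A} → All P xs → All P (reverse xs)
All-reverse⁺ pxs = All.tabulate (All.lookup pxs ∘ Any.reverse⁻)

AllPairs-reverse⁺ : {R : A → A → Set} {xs : List A} → AllPairs (flip R) xs → AllPairs R (reverse xs)
AllPairs-reverse⁺ [] = []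
AllPairs-reverse⁺ {R = R} {xs = x ∷ xs} (x~xs ∷ pxs) =
  subst (AllPairs R) (sym (unfold-reverse x xs))
    (AllPairs.++⁺ (AllPairs-reverse⁺ pxs) ([] ∷ []) (All-reverse⁺ (All.map (_∷ []) x~xs)))

AllPairs-lookup : {R : A → A → Set} {xs : List A} → AllPairs R xs → lookup xs Preserves F._<_ ⟶ R
AllPairs-lookup (x~xs ∷ _) {zero}   {suc j} _         = All.lookup x~xs (∈-lookup j)
AllPairs-lookup (_ ∷ pxs)  {suc i} {suc j} (s≤s i<j) = AllPairs-lookup pxs i<j

length-≤-unique : {xs ys : List A} → Unique xs → All (_∈ ys) xs → length xs ≤ length ys
length-≤-unique [] [] = z≤n
length-≤-unique {xs = x ∷ xs} (x∉xs ∷ xs!) (x∈ys ∷ xs⊆ys)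
  with ys₁ , ys₂ , refl ← ∈-∃++ x∈ys = begin
    suc (length xs)               ≤⟨ s≤s (length-≤-unique xs! (All.zipWith ∈-without-x (x∉xs , xs⊆ys))) ⟩
    suc (length (ys₁ ++ ys₂))     ≡⟨ cong suc (length-++ ys₁) ⟩
    suc (length ys₁ + length ys₂) ≡⟨ +-suc (length ys₁) (length ys₂) ⟨
    length ys₁ + length (x ∷ ys₂) ≡⟨ length-++ ys₁ ⟨
    length (ys₁ ++ x ∷ ys₂)       ∎
  where
  open ≤-Reasoning
  ∈-without-x : ∀ {y} → ¬ x ≡ y × y ∈ ys₁ ++ x ∷ ys₂ → y ∈ ys₁ ++ ys₂
  ∈-without-x (x≢y , y∈ys) with ∈-++⁻ ys₁ y∈ys
  ... | inj₁ y∈ys₁         = ∈-++⁺ˡ y∈ys₁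
  ... | inj₂ (here y≡x)    = ⊥-elim (x≢y (sym y≡x))
  ... | inj₂ (there y∈ys₂) = ∈-++⁺ʳ ys₁ y∈ys₂

antidiagonal : ℕ → List (ℕ × ℕ)
antidiagonal zero    = [ (0 , 0) ]
antidiagonal (suc s) = (0 , suc s) ∷ map (map₁ suc) (antidiagonal s)

∈-antidiagonal : ∀ a b → (a , b) ∈ antidiagonal (a + b)
∈-antidiagonal zero    zero    = here refl
∈-antidiagonal zero    (suc b) = here refl
∈-antidiagonal (suc a) b       = there (∈-map⁺ (map₁ suc) (∈-antidiagonal a b))

length-antidiagonal : ∀ s → length (antidiagonal s) ≡ suc s
length-antidiagonal zero    = refl
length-antidiagonal (suc s) = cong suc (trans (length-map (map₁ suc) (antidiagonal s)) (length-antidiagonal s))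

triangle : ℕ → List (ℕ × ℕ)
triangle zero    = []
triangle (suc m) = antidiagonal m ++ triangle m

∈-triangle : ∀ {a b} m → a + b < m → (a , b) ∈ triangle m
∈-triangle {a} {b} (suc m) (s≤s a+b≤m) with m≤n⇒m<n∨m≡n a+b≤m
... | inj₁ a+b<m = ∈-++⁺ʳ (antidiagonal m) (∈-triangle m a+b<m)
... | inj₂ refl  = ∈-++⁺ˡ (∈-antidiagonal a b)

length-triangle : ∀ m → length (triangle m) ≡ suc m C 2
length-triangle zero    = refl
length-triangle (suc m) = begin
  length (antidiagonal m ++ triangle m)           ≡⟨ length-++ (antidiagonal m) ⟩
  length (antidiagonal m) + length (triangle m)   ≡⟨ cong₂ _+_ (length-antidiagonal m) (length-triangle m) ⟩
  suc m + suc m C 2                               ≡⟨ cong (_+ suc m C 2) (nC1≡n (suc m)) ⟨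
  suc m C 1 + suc m C 2                           ≡⟨ nCk+nC[k+1]≡[n+1]C[k+1] (suc m) 1 ⟩
  suc (suc m) C 2                                 ∎
  where open ≡-Reasoning

length-≤-pairs-below : ∀ m {ps : List (ℕ × ℕ)} → Unique ps → All (λ (a , b) → a + b < m) ps →
  length ps ≤ suc m C 2
length-≤-pairs-below m {ps} ps! below = subst (length ps ≤_) (length-triangle m)
  (length-≤-unique ps! (All.map (∈-triangle m) below))

module LongestChain {R : A → A → Set} (R-trans : Transitive R) (R? : Decidable R) where

  -- the length of a longest R-chain in ys all of whose entries are R-above x
  longestChain : A → List A → ℕ
  longestChain x []       = 0
  longestChain x (y ∷ ys) with R? x y
  ... | yes _ = longestChain x ys ⊔ suc (longestChain y ys)
  ... | no  _ = longestChain x ys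

  longestChain-realised : ∀ x ys →
    Σ (List A) λ L → L ⊆ ys × AllPairs R (x ∷ L) × length L ≡ longestChain x ys
  longestChain-realised x [] = [] , [] , [] ∷ [] , refl
  longestChain-realised x (y ∷ ys) with R? x y
  ... | no _ with L , L⊆ys , x∷L↑ , ∣L∣ ← longestChain-realised x ys = L , y ∷ʳ L⊆ys , x∷L↑ , ∣L∣
  ... | yes xRy with ⊔-sel (longestChain x ys) (suc (longestChain y ys))
  ...   | inj₁ ⊔≡ˡ with L , L⊆ys , x∷L↑ , ∣L∣ ← longestChain-realised x ys =
    L , y ∷ʳ L⊆ys , x∷L↑ , trans ∣L∣ (sym ⊔≡ˡ)
  ...   | inj₂ ⊔≡ʳ with L , L⊆ys , y∷L↑@(yRL ∷ _) , ∣L∣ ← longestChain-realised y ys =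
    y ∷ L , refl ∷ L⊆ys , (xRy ∷ All.map (R-trans xRy) yRL) ∷ y∷L↑ , trans (cong suc ∣L∣) (sym ⊔≡ʳ)

  longestChain-≤-∷ : ∀ x y ys → longestChain x ys ≤ longestChain x (y ∷ ys)
  longestChain-≤-∷ x y ys with R? x y
  ... | yes _ = m≤m⊔n _ _
  ... | no  _ = ≤-refl

  longestChain-<-∷ : ∀ {x y} ys → R x y → longestChain y ys < longestChain x (y ∷ ys)
  longestChain-<-∷ {x} {y} ys xRy with R? x y
  ... | yes _   = m≤n⊔m (longestChain x ys) _
  ... | no ¬xRy = ⊥-elim (¬xRy xRy)

open LongestChain {R = _<_} <-trans _<?_ using ()
  renaming (longestChain to ascent; longestChain-realised to ascent-realised;
            longestChain-≤-∷ to ascent-≤-∷; longestChain-<-∷ to ascent-<-∷)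
open LongestChain {R = _>_} (flip <-trans) _>?_ using ()
  renaming (longestChain to descent; longestChain-realised to descent-realised;
            longestChain-≤-∷ to descent-≤-∷; longestChain-<-∷ to descent-<-∷)

labels : List ℕ → List (ℕ × ℕ)
labels []       = []
labels (x ∷ xs) = (ascent x xs , descent x xs) ∷ labels xs

length-labels : ∀ xs → length (labels xs) ≡ length xs
length-labels []       = refl
length-labels (x ∷ xs) = cong suc (length-labels xs)

-- Stated for upper bounds a, b of the label of x so that the induction can skip entries.
labels-fresh : ∀ {x a b} xs → All (λ y → ¬ x ≡ y) xs → ascent x xs ≤ a → descent x xs ≤ b →
  All (λ p → ¬ (a , b) ≡ p) (labels xs)
labels-fresh [] [] _ _ = []
labels-fresh {x} {a} {b} (y ∷ ys) (x≢y ∷ x∉ys) asc≤a desc≤b =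
  label-y-differs ∷ labels-fresh ys x∉ys (≤-trans (ascent-≤-∷ x y ys) asc≤a) (≤-trans (descent-≤-∷ x y ys) desc≤b)
  where
  label-y-differs : ¬ (a , b) ≡ (ascent y ys , descent y ys)
  label-y-differs refl with <-cmp x y
  ... | tri< x<y _ _ = <⇒≱ (ascent-<-∷ ys x<y) asc≤a
  ... | tri≈ _ x≡y _ = x≢y x≡y
  ... | tri> _ _ x>y = <⇒≱ (descent-<-∷ ys x>y) desc≤b

labels-unique : ∀ {xs} → Unique xs → Unique (labels xs)
labels-unique []          = []
labels-unique {x ∷ xs} (x∉xs ∷ xs!) = labels-fresh xs x∉xs ≤-refl ≤-refl ∷ labels-unique xs!

HasIncreasingSublist : ℕ → List ℕ → Set
HasIncreasingSublist ℓ ws = Σ (List ℕ) λ zs → zs ⊆ ws × AllPairs _<_ zs × ℓ ≤ length zs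

HasIncreasingSublist-mono : ∀ {ℓ ℓ′ ws ws′} → ℓ′ ≤ ℓ → ws ⊆ ws′ →
  HasIncreasingSublist ℓ ws → HasIncreasingSublist ℓ′ ws′
HasIncreasingSublist-mono ℓ′≤ℓ ws⊆ws′ (zs , zs⊆ws , zs↑ , ℓ≤∣zs∣) =
  zs , ⊆-trans zs⊆ws ws⊆ws′ , zs↑ , ≤-trans ℓ′≤ℓ ℓ≤∣zs∣

reverse++-⊆-∷ : ∀ (x : A) ys → reverse ys ++ ys ⊆ reverse (x ∷ ys) ++ x ∷ ys
reverse++-⊆-∷ x ys = Sublist.++⁺ (Sublist.reverse⁺ {as = ys} (x ∷ʳ ⊆-refl)) (x ∷ʳ ⊆-refl)

-- A longest decreasing chain after x, reversed, then x, then a longest increasing chain after x.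
increasing-through : ∀ x ys →
  HasIncreasingSublist (suc (ascent x ys + descent x ys)) (reverse (x ∷ ys) ++ x ∷ ys)
increasing-through x ys
  with I , I⊆ys , x<I ∷ I↑ , ∣I∣ ← ascent-realised x ys
     | D , D⊆ys , x∷D↓@(x>D ∷ _) , ∣D∣ ← descent-realised x ys =
  reverse (x ∷ D) ++ I ,
  Sublist.++⁺ (Sublist.reverse⁺ (refl ∷ D⊆ys)) (x ∷ʳ I⊆ys) ,
  AllPairs.++⁺ (AllPairs-reverse⁺ x∷D↓) I↑ (All-reverse⁺ (All.map below-I (≤-refl ∷ All.map <⇒≤ x>D))) ,
  ≤-reflexive length-eq
  where
  below-I : ∀ {y} → y ≤ x → All (y <_) I
  below-I y≤x = All.map (≤-<-trans y≤x) x<I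
  open ≡-Reasoning
  length-eq : suc (ascent x ys + descent x ys) ≡ length (reverse (x ∷ D) ++ I)
  length-eq = begin
    suc (ascent x ys + descent x ys)        ≡⟨ cong suc (cong₂ _+_ ∣I∣ ∣D∣) ⟨
    suc (length I + length D)               ≡⟨ cong suc (+-comm (length I) (length D)) ⟩
    length (x ∷ D) + length I               ≡⟨ cong (_+ length I) (length-reverse (x ∷ D)) ⟨
    length (reverse (x ∷ D)) + length I     ≡⟨ length-++ (reverse (x ∷ D)) ⟨
    length (reverse (x ∷ D) ++ I)           ∎

increasing-from-long-label : ∀ {m} xs → Any (λ (a , b) → m ≤ a + b) (labels xs) →
  HasIncreasingSublist (suc m) (reverse xs ++ xs)
increasing-from-long-label (x ∷ ys) (here m≤a+b) =
  HasIncreasingSublist-mono (s≤s m≤a+b) ⊆-refl (increasing-through x ys)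
increasing-from-long-label (x ∷ ys) (there long) =
  HasIncreasingSublist-mono ≤-refl (reverse++-⊆-∷ x ys) (increasing-from-long-label ys long)

reverse++-increasing : ∀ m xs → Unique xs → suc m C 2 < length xs →
  HasIncreasingSublist (suc m) (reverse xs ++ xs)
reverse++-increasing m xs xs! long with any? (λ (a , b) → m ≤? a + b) (labels xs)
... | yes long-label   = increasing-from-long-label xs long-label
... | no ¬long-label   = ⊥-elim (<⇒≱ long (begin
  length xs            ≡⟨ length-labels xs ⟨
  length (labels xs)   ≤⟨ length-≤-pairs-below m (labels-unique xs!) all-short ⟩
  suc m C 2            ∎))
  where
  open ≤-Reasoning
  all-short : All (λ (a , b) → a + b < m) (labels xs)
  all-short = All.map ≰⇒> (All.¬Any⇒All¬ (labels xs) ¬long-label)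

tabulate-∷ʳ : ∀ {n} (w : Fin (suc n) → A) → tabulate w ≡ tabulate (w ∘ inject₁) ++ [ w (fromℕ n) ]
tabulate-∷ʳ {n = zero}  w = refl
tabulate-∷ʳ {n = suc n} w = cong (w zero ∷_) (tabulate-∷ʳ (w ∘ suc))

tabulate-reverseW : ∀ {n} (w : Word n) → tabulate (reverseW w) ≡ reverse (tabulate w)
tabulate-reverseW {zero}  w = refl
tabulate-reverseW {suc n} w = begin
  w (fromℕ n) ∷ tabulate (reverseW (w ∘ inject₁))    ≡⟨ cong (w (fromℕ n) ∷_) (tabulate-reverseW (w ∘ inject₁)) ⟩
  w (fromℕ n) ∷ reverse (tabulate (w ∘ inject₁))     ≡⟨ reverse-++ (tabulate (w ∘ inject₁)) [ w (fromℕ n) ] ⟨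
  reverse (tabulate (w ∘ inject₁) ++ [ w (fromℕ n) ]) ≡⟨ cong reverse (tabulate-∷ʳ w) ⟨
  reverse (tabulate w)                                ∎
  where open ≡-Reasoning

concatW-suc : ∀ {m l} (u : Word (suc m)) (v : Word l) (i : Fin (m + l)) →
  concatW u v (suc i) ≡ concatW (u ∘ suc) v i
concatW-suc {m} u v i with splitAt m i
... | inj₁ _ = refl
... | inj₂ _ = refl

tabulate-concatW : ∀ {m l} (u : Word m) (v : Word l) → tabulate (concatW u v) ≡ tabulate u ++ tabulate v
tabulate-concatW {zero}  u v = refl
tabulate-concatW {suc m} u v =
  cong (u zero ∷_) (trans (tabulate-cong (concatW-suc u v)) (tabulate-concatW (u ∘ suc) v))

reverseW-injective : ∀ {n} {w : Word n} → (∀ {i j} → w i ≡ w j → i ≡ j) →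
  ∀ {i j} → reverseW w i ≡ reverseW w j → i ≡ j
reverseW-injective w-inj {i} {j} eq =
  trans (sym (opposite-involutive i)) (trans (cong opposite (w-inj eq)) (opposite-involutive j))

oneLine-injective : ∀ {n} (π : Permutation n n) → ∀ {i j} → oneLine π i ≡ oneLine π j → i ≡ j
oneLine-injective π {i} {j} eq = begin
  i                  ≡⟨ inverseˡ π ⟨
  π ⟨$⟩ˡ (π ⟨$⟩ʳ i)  ≡⟨ cong (π ⟨$⟩ˡ_) (toℕ-injective (suc-injective eq)) ⟩
  π ⟨$⟩ˡ (π ⟨$⟩ʳ j)  ≡⟨ inverseˡ π ⟩
  j                  ∎
  where open ≡-Reasoning

doubleList-as-list : ∀ {n} (π : Permutation n n) →
  reverse (tabulate (reverseW (oneLine π))) ++ tabulate (reverseW (oneLine π)) ≡ tabulate (doubleList π)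
doubleList-as-list π = begin
  reverse ρ ++ ρ                      ≡⟨ cong (λ ys → reverse ys ++ ρ) (tabulate-reverseW o) ⟩
  reverse (reverse (tabulate o)) ++ ρ ≡⟨ cong (_++ ρ) (reverse-involutive (tabulate o)) ⟩
  tabulate o ++ ρ                     ≡⟨ tabulate-concatW o (reverseW o) ⟨
  tabulate (doubleList π)             ∎
  where
  open ≡-Reasoning
  o = oneLine π
  ρ = tabulate (reverseW o)

sublist-tabulate-reindexing : ∀ {M} (w : Fin M → A) {zs} → zs ⊆ tabulate w →
  Σ (Fin (length zs) → Fin M) λ g → g Preserves F._<_ ⟶ F._<_ × (∀ i → w (g i) ≡ lookup zs i)
sublist-tabulate-reindexing {M = zero} w [] = (λ ()) , (λ { {()} }) , (λ ())
sublist-tabulate-reindexing {M = suc M} w (_ ∷ʳ zs⊆w)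
  with g , g-mono , w∘g ← sublist-tabulate-reindexing (w ∘ suc) zs⊆w =
  suc ∘ g , s≤s ∘ g-mono , w∘g
sublist-tabulate-reindexing {M = suc M} w {z ∷ zs} (w0≡z ∷ zs⊆w)
  with g , g-mono , w∘g ← sublist-tabulate-reindexing (w ∘ suc) zs⊆w = g′ , g′-mono , w∘g′
  where
  g′ : Fin (suc (length zs)) → Fin (suc M)
  g′ zero    = zero
  g′ (suc i) = suc (g i)
  g′-mono : g′ Preserves F._<_ ⟶ F._<_
  g′-mono {zero}  {suc _} _         = s≤s z≤n
  g′-mono {suc _} {suc _} (s≤s i<j) = s≤s (g-mono i<j)
  w∘g′ : ∀ i → w (g′ i) ≡ lookup (z ∷ zs) i
  w∘g′ zero    = sym w0≡z
  w∘g′ (suc i) = w∘g i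

increasing⇒matches-identityPattern : ∀ {k} (f : Word k) → f Preserves F._<_ ⟶ _<_ →
  ∀ a b → f a ≤ f b ⇔ identityPattern k a ≤ identityPattern k b
increasing⇒matches-identityPattern f f-mono a b = mk⇔ to from
  where
  to : f a ≤ f b → suc (toℕ a) ≤ suc (toℕ b)
  to fa≤fb = s≤s (≮⇒≥ λ b<a → <⇒≱ (f-mono b<a) fa≤fb)
  from : suc (toℕ a) ≤ suc (toℕ b) → f a ≤ f b
  from (s≤s a≤b) with m≤n⇒m<n∨m≡n a≤b
  ... | inj₁ a<b = <⇒≤ (f-mono a<b)
  ... | inj₂ a≡b = ≤-reflexive (cong f (toℕ-injective a≡b))

increasing-sublist⇒contains : ∀ {M k} (w : Word M) →
  HasIncreasingSublist k (tabulate w) → Contains w (identityPattern k)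
increasing-sublist⇒contains {k = k} w (zs , zs⊆w , zs↑ , k≤∣zs∣)
  with g , g-mono , w∘g ← sublist-tabulate-reindexing w zs⊆w =
  g ∘ inj , (λ _ _ → g-mono ∘ inj-mono) , increasing⇒matches-identityPattern (w ∘ g ∘ inj) w∘g∘inj-mono
  where
  inj : Fin k → Fin (length zs)
  inj a = inject≤ a k≤∣zs∣
  inj-mono : inj Preserves F._<_ ⟶ F._<_
  inj-mono {a} {b} = subst₂ _<_ (sym (toℕ-inject≤ a k≤∣zs∣)) (sym (toℕ-inject≤ b k≤∣zs∣))
  w∘g∘inj-mono : (w ∘ g ∘ inj) Preserves F._<_ ⟶ _<_
  w∘g∘inj-mono {a} {b} a<b =
    subst₂ _<_ (sym (w∘g (inj a))) (sym (w∘g (inj b))) (AllPairs-lookup zs↑ (inj-mono a<b))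

theorem1 : (k : ℕ) → 1 ≤ k → (n : ℕ) → suc (k C 2) ≤ n →
    (π : Permutation n n) → Contains (doubleList π) (identityPattern k)
theorem1 (suc m) _ n C<n π = increasing-sublist⇒contains (doubleList π)
  (subst (HasIncreasingSublist (suc m)) (doubleList-as-list π)
    (reverse++-increasing m ρ ρ-unique (subst (suc m C 2 <_) (sym (length-tabulate (reverseW o))) C<n)))
  where
  o = oneLine π
  ρ = tabulate (reverseW o)
  ρ-unique : Unique ρ
  ρ-unique = Unique.tabulate⁺ (reverseW-injective (oneLine-injective π))
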